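{- For every formula $\varphi$ of the language of monadic second-order logic over $\omega$-words, if $\vdash\varphi$ is derivable in $\mathsf{MSO}$, then $\vdash\lnot\lnot\varphi$ is derivable in $\mathsf{SMSO}$. (More generally, if $\vec\varphi\vdash\varphi$ is derivable in $\mathsf{MSO}$ then $\vec\varphi\vdash\lnot\lnot\varphi$ is derivable in $\mathsf{SMSO}$.)
   Context: \emph{Language.} Two-sorted: individual variables $x,y,z,\dots$, predicate variables $X,Y,Z,\dots$. Atomic formulae $\alpha$: $x\doteq y$, $x\leq y$, $\mathsf S(x,y)$, $\mathsf{Zero}(x)$, $x\in X$, $\top$, $\bot$. Deterministic formulae $\delta ::= \alpha\mid\delta\wedge\delta'\mid\lnot\varphi$; formulae $\varphi ::= \delta\mid\varphi\wedge\psi\mid\exists x\varphi\mid\exists X\varphi$ (no primitive $\vee,\to,\forall$). \emph{Substitution.} $\varphi[\psi[y]/X]$ is capture-avoiding replacement of every atom $t\in X$ by $\psi[t/y]$. \emph{Relativization:} $\alpha|\theta[y]:=\alpha$, commuting with $\wedge,\lnot,\exists X$, and $(\exists x\varphi)|\theta[y]:=\exists x(\theta[x/y]\wedge\varphi|\theta[y])$. A formula is \emph{uniformly bounded by $x$} if it has the form $\psi|(y\leq x)[y]$ and $x$ is its only free individual variable. \emph{Logical rules} (sequents $\vec\varphi\vdash\varphi$): axiom $\vec\varphi,\varphi\vdash\varphi$; cut; from $\vec\varphi\vdash\varphi$, $\vec\varphi\vdash\lnot\varphi$ infer $\vec\varphi\vdash\bot$; from $\vec\varphi,\varphi\vdash\bot$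 infer $\vec\varphi\vdash\lnot\varphi$; $\wedge$-intro and $\wedge$-eliminations; $\exists$-introductions from $\varphi[y/x]$ resp. $\varphi[Y/X]$; $\exists$-eliminations (from $\vec\varphi\vdash\exists x\varphi$ and $\vec\varphi,\varphi\vdash\psi$ infer $\vec\varphi\vdash\psi$, $x$ not free in $\vec\varphi,\psi$; same for $X$). \emph{Arithmetic rules} (common context $\vec\varphi$): $\vdash x\doteq x$; from $\varphi[y/x]$, $y\doteq z$ infer $\varphi[z/x]$; reflexivity, transitivity of $\leq$ and from $x\leq y,y\leq x$ infer $x\doteq y$; $\vdash\exists y\,\mathsf{Zero}(y)$; from $\mathsf{Zero}(x),\mathsf{Zero}(y)$ infer $x\doteq y$; $\vdash\exists y\,\mathsf S(x,y)$; from $\mathsf S(y,x),\mathsf S(z,x)$ infer $y\doteq z$; from $\mathsf S(x,y),\mathsf S(x,z)$ infer $y\doteq z$; from $\mathsf S(x,y),\mathsf{Zero}(y)$ infer $\bot$; from $\mathsf S(x,y)$ infer $x\leq y$; from $\mathsf S(y,y')$, $x\leq y'$, $\lnot(x\doteq y')$ infer $x\leq y$. \emph{$\mathsf{MSO}$}: logical and arithmetic rules, plus double negation elimination (from $\vec\varphi\vdash\lnot\lnot\varphi$ infer $\vec\varphi\vdash\varphi$), comprehension (from $\vec\varphi\vdash\varphi[\psi[y]/X]$ infer $\vec\varphi\vdash\exists X\varphi$) and induction (from $\vec\varphi,\mathsf{Zero}(z)\vdash\varphi[z/x]$ and $\vec\varphi,\mathsf S(y,z),\varphi[y/x]\vdash\varphi[z/x]$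 infer $\vec\varphi\vdash\varphi$, with $y,z$ not free in $\vec\varphi,\varphi$). \emph{$\mathsf{SMSO}$}: logical and arithmetic rules, plus negative comprehension (from $\vec\varphi\vdash\varphi[\psi[y]/X]$ infer $\vec\varphi\vdash\lnot\lnot\exists X\varphi$), induction restricted to deterministic $\varphi=\delta$, double negation elimination restricted to deterministic formulae, and synchronous comprehension (from $\vec\varphi\vdash\psi[\hat\varphi[y]/X]$ infer $\vec\varphi\vdash\exists X\psi$ with $\hat\varphi$ uniformly bounded by $y$). -}

module Defs where

open import Data.Nat using (ℕ; zero; suc)
open import Data.Fin using (Fin; zero; suc; _≟_)
open import Data.List using (List; _∷_; []; map)
open import Data.List.Membership.Propositional using (_∈_)
open import Data.Product using (Σ)
open import Data.Unit using (⊤)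
open import Relation.Nullary using (yes; no)
open import Relation.Binary.PropositionalEquality using (_≡_)

-- Formula n m : formulas whose free individual variables are among
-- Fin n and whose free predicate variables are among Fin m.
-- (Individual variable 0 / predicate variable 0 is the innermost bound.)

infixr 6 _∧_
infix 7 ¬_

data Formula (n m : ℕ) : Set where
  _≐_   : Fin n → Fin n → Formula n m
  _≤ᶠ_  : Fin n → Fin n → Formula n m
  S     : Fin n → Fin n → Formula n m
  Zero  : Fin n → Formula n m
  _∈ᶠ_  : Fin n → Fin m → Formula n m
  ⊤ᶠ    : Formula n m
  ⊥ᶠ    : Formula n m
  _∧_   : Formula n m → Formula n m → Formula n m
  ¬_    : Formula n m → Formula n m
  ∃₁    : Formula (suc n) m → Formula n m
  ∃₂    : Formula n (suc m) → Formula n m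

data Det {n m : ℕ} : Formula n m → Set where
  det-≐  : ∀ x y → Det (x ≐ y)
  det-≤  : ∀ x y → Det (x ≤ᶠ y)
  det-S  : ∀ x y → Det (S x y)
  det-Z  : ∀ x → Det (Zero x)
  det-∈  : ∀ x X → Det (x ∈ᶠ X)
  det-⊤  : Det ⊤ᶠ
  det-⊥  : Det ⊥ᶠ
  det-∧  : ∀ {δ δ'} → Det δ → Det δ' → Det (δ ∧ δ')
  det-¬  : ∀ φ → Det (¬ φ)

renI : ∀ {n n' m} → (Fin n → Fin n') → Formula n m → Formula n' m
liftI : ∀ {n n'} → (Fin n → Fin n') → Fin (suc n) → Fin (suc n')
liftI ρ zero = zero
liftI ρ (suc i) = suc (ρ i)
renI ρ (x ≐ y) = ρ x ≐ ρ y
renI ρ (x ≤ᶠ y) = ρ x ≤ᶠ ρ y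
renI ρ (S x y) = S (ρ x) (ρ y)
renI ρ (Zero x) = Zero (ρ x)
renI ρ (x ∈ᶠ X) = ρ x ∈ᶠ X
renI ρ ⊤ᶠ = ⊤ᶠ
renI ρ ⊥ᶠ = ⊥ᶠ
renI ρ (φ ∧ ψ) = renI ρ φ ∧ renI ρ ψ
renI ρ (¬ φ) = ¬ renI ρ φ
renI ρ (∃₁ φ) = ∃₁ (renI (liftI ρ) φ)
renI ρ (∃₂ φ) = ∃₂ (renI ρ φ)

liftP : ∀ {m m'} → (Fin m → Fin m') → Fin (suc m) → Fin (suc m')
liftP ρ zero = zero
liftP ρ (suc i) = suc (ρ i)

renP : ∀ {n m m'} → (Fin m → Fin m') → Formula n m → Formula n m'
renP ρ (x ≐ y) = x ≐ y
renP ρ (x ≤ᶠ y) = x ≤ᶠ y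
renP ρ (S x y) = S x y
renP ρ (Zero x) = Zero x
renP ρ (x ∈ᶠ X) = x ∈ᶠ ρ X
renP ρ ⊤ᶠ = ⊤ᶠ
renP ρ ⊥ᶠ = ⊥ᶠ
renP ρ (φ ∧ ψ) = renP ρ φ ∧ renP ρ ψ
renP ρ (¬ φ) = ¬ renP ρ φ
renP ρ (∃₁ φ) = ∃₁ (renP ρ φ)
renP ρ (∃₂ φ) = ∃₂ (renP (liftP ρ) φ)

wkI : ∀ {n m} → Formula n m → Formula (suc n) m
wkI = renI suc

wkP : ∀ {n m} → Formula n m → Formula n (suc m)
wkP = renP suc

inst : ∀ {n} → Fin n → Fin (suc n) → Fin n
inst y zero = y
inst y (suc i) = i

_[_/₁] : ∀ {n m} → Formula (suc n) m → Fin n → Formula n m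
φ [ y /₁] = renI (inst y) φ

_[_/₂] : ∀ {n m} → Formula n (suc m) → Fin m → Formula n m
φ [ Y /₂] = renP (inst Y) φ

repl : ∀ {n n'} → Fin n → Fin n' → (Fin n → Fin n') → Fin n → Fin n'
repl x t f i with i ≟ x
... | yes _ = t
... | no  _ = f i

-- A "formula with parameter y" ψ[y] over scope (n , m') is an element of
-- Formula (suc n) m' whose individual variable 0 is the parameter y.

-- shift a parametrised formula under an individual binder
-- (parameter stays 0, the other variables move past the new binder)
upI : ∀ {n m} → Formula (suc n) m → Formula (suc (suc n)) m
upI = renI (liftI suc)

substP : ∀ {n m m'} → (Fin m → Formula (suc n) m') → Formula n m → Formula n m'
substP σ (x ≐ y) = x ≐ y
substP σ (x ≤ᶠ y) = x ≤ᶠ y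
substP σ (S x y) = S x y
substP σ (Zero x) = Zero x
substP σ (x ∈ᶠ X) = σ X [ x /₁]
substP σ ⊤ᶠ = ⊤ᶠ
substP σ ⊥ᶠ = ⊥ᶠ
substP σ (φ ∧ ψ) = substP σ φ ∧ substP σ ψ
substP σ (¬ φ) = ¬ substP σ φ
substP σ (∃₁ φ) = ∃₁ (substP (λ X → upI (σ X)) φ)
substP σ (∃₂ φ) = ∃₂ (substP σ' φ)
  where
  σ' : Fin (suc _) → Formula (suc _) (suc _)
  σ' zero = zero ∈ᶠ zero
  σ' (suc X) = wkP (σ X)

_[_/X] : ∀ {n m} → Formula n (suc m) → Formula (suc n) m → Formula n m
φ [ ψ /X] = substP σ φ
  where
  σ : Fin (suc _) → Formula (suc _) _
  σ zero = ψ
  σ (suc X) = zero ∈ᶠ X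

rel : ∀ {n m} → Formula (suc n) m → Formula n m → Formula n m
rel θ (x ≐ y) = x ≐ y
rel θ (x ≤ᶠ y) = x ≤ᶠ y
rel θ (S x y) = S x y
rel θ (Zero x) = Zero x
rel θ (x ∈ᶠ X) = x ∈ᶠ X
rel θ ⊤ᶠ = ⊤ᶠ
rel θ ⊥ᶠ = ⊥ᶠ
rel θ (φ ∧ ψ) = rel θ φ ∧ rel θ ψ
rel θ (¬ φ) = ¬ rel θ φ
-- (∃x φ)|θ[y] := ∃x (θ[x/y] ∧ φ|θ[y]); under the binder x is index 0,
-- so θ[x/y] is θ itself read in scope (suc n).
rel θ (∃₁ φ) = ∃₁ (θ ∧ rel (upI θ) φ)
rel θ (∃₂ φ) = ∃₂ (rel (wkP θ) φ)

-- The bound θ = (y ≤ x) lives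
-- in scope 2 with y = index 0 (parameter) and x = index 1.
boundedBy : ∀ {m} → Formula 1 m → Formula 1 m
boundedBy ψ = rel (zero ≤ᶠ suc zero) ψ

-- A parametrised formula φ̂[y] (scope suc n, parameter y = index 0) that is
-- uniformly bounded by y: it is (the embedding of) a formula ψ|(z ≤ y)[z]
-- whose only free individual variable is y.
UniformlyBounded : ∀ {n m} → Formula (suc n) m → Set
UniformlyBounded {n} {m} φ̂ =
  Σ (Formula 1 m) (λ ψ → φ̂ ≡ renI (λ (_ : Fin 1) → zero) (boundedBy ψ))

data System : Set where
  mso smso : System

Restr : System → ∀ {n m} → Formula n m → Set
Restr mso  φ = ⊤
Restr smso φ = Det φ

infix 3 _∣_⊢_

data _∣_⊢_ (s : System) : ∀ {n m} → List (Formula n m) → Formula n m → Set where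
  ax    : ∀ {n m} {Γ : List (Formula n m)} {φ} → φ ∈ Γ → s ∣ Γ ⊢ φ
  cut   : ∀ {n m} {Γ : List (Formula n m)} {φ ψ} →
          s ∣ Γ ⊢ φ → s ∣ φ ∷ Γ ⊢ ψ → s ∣ Γ ⊢ ψ
  ¬E    : ∀ {n m} {Γ : List (Formula n m)} {φ} →
          s ∣ Γ ⊢ φ → s ∣ Γ ⊢ ¬ φ → s ∣ Γ ⊢ ⊥ᶠ
  ¬I    : ∀ {n m} {Γ : List (Formula n m)} {φ} →
          s ∣ φ ∷ Γ ⊢ ⊥ᶠ → s ∣ Γ ⊢ ¬ φ
  ∧I    : ∀ {n m} {Γ : List (Formula n m)} {φ ψ} →
          s ∣ Γ ⊢ φ → s ∣ Γ ⊢ ψ → s ∣ Γ ⊢ φ ∧ ψ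
  ∧E₁   : ∀ {n m} {Γ : List (Formula n m)} {φ ψ} → s ∣ Γ ⊢ φ ∧ ψ → s ∣ Γ ⊢ φ
  ∧E₂   : ∀ {n m} {Γ : List (Formula n m)} {φ ψ} → s ∣ Γ ⊢ φ ∧ ψ → s ∣ Γ ⊢ ψ
  ∃I₁   : ∀ {n m} {Γ : List (Formula n m)} {φ} (y : Fin n) →
          s ∣ Γ ⊢ φ [ y /₁] → s ∣ Γ ⊢ ∃₁ φ
  ∃I₂   : ∀ {n m} {Γ : List (Formula n m)} {φ} (Y : Fin m) →
          s ∣ Γ ⊢ φ [ Y /₂] → s ∣ Γ ⊢ ∃₂ φ
  ∃E₁   : ∀ {n m} {Γ : List (Formula n m)} {φ ψ} →
          s ∣ Γ ⊢ ∃₁ φ → s ∣ φ ∷ map wkI Γ ⊢ wkI ψ → s ∣ Γ ⊢ ψ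
  ∃E₂   : ∀ {n m} {Γ : List (Formula n m)} {φ ψ} →
          s ∣ Γ ⊢ ∃₂ φ → s ∣ φ ∷ map wkP Γ ⊢ wkP ψ → s ∣ Γ ⊢ ψ
  ≐refl : ∀ {n m} {Γ : List (Formula n m)} (x : Fin n) → s ∣ Γ ⊢ x ≐ x
  ≐subst : ∀ {n m} {Γ : List (Formula n m)} (φ : Formula (suc n) m) {y z} →
          s ∣ Γ ⊢ φ [ y /₁] → s ∣ Γ ⊢ y ≐ z → s ∣ Γ ⊢ φ [ z /₁]
  ≤refl : ∀ {n m} {Γ : List (Formula n m)} (x : Fin n) → s ∣ Γ ⊢ x ≤ᶠ x
  ≤trans : ∀ {n m} {Γ : List (Formula n m)} {x y z} →
          s ∣ Γ ⊢ x ≤ᶠ y → s ∣ Γ ⊢ y ≤ᶠ z → s ∣ Γ ⊢ x ≤ᶠ z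
  ≤antisym : ∀ {n m} {Γ : List (Formula n m)} {x y} →
          s ∣ Γ ⊢ x ≤ᶠ y → s ∣ Γ ⊢ y ≤ᶠ x → s ∣ Γ ⊢ x ≐ y
  zeroEx : ∀ {n m} {Γ : List (Formula n m)} → s ∣ Γ ⊢ ∃₁ (Zero zero)
  zeroUniq : ∀ {n m} {Γ : List (Formula n m)} {x y} →
          s ∣ Γ ⊢ Zero x → s ∣ Γ ⊢ Zero y → s ∣ Γ ⊢ x ≐ y
  succEx : ∀ {n m} {Γ : List (Formula n m)} (x : Fin n) →
          s ∣ Γ ⊢ ∃₁ (S (suc x) zero)
  succInj : ∀ {n m} {Γ : List (Formula n m)} {x y z} →
          s ∣ Γ ⊢ S y x → s ∣ Γ ⊢ S z x → s ∣ Γ ⊢ y ≐ z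
  succFun : ∀ {n m} {Γ : List (Formula n m)} {x y z} →
          s ∣ Γ ⊢ S x y → s ∣ Γ ⊢ S x z → s ∣ Γ ⊢ y ≐ z
  succZero : ∀ {n m} {Γ : List (Formula n m)} {x y} →
          s ∣ Γ ⊢ S x y → s ∣ Γ ⊢ Zero y → s ∣ Γ ⊢ ⊥ᶠ
  succ≤ : ∀ {n m} {Γ : List (Formula n m)} {x y} →
          s ∣ Γ ⊢ S x y → s ∣ Γ ⊢ x ≤ᶠ y
  ≤pred : ∀ {n m} {Γ : List (Formula n m)} {x y y'} →
          s ∣ Γ ⊢ S y y' → s ∣ Γ ⊢ x ≤ᶠ y' → s ∣ Γ ⊢ ¬ (x ≐ y') →
          s ∣ Γ ⊢ x ≤ᶠ y
  dne   : ∀ {n m} {Γ : List (Formula n m)} {φ} → Restr s φ →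
          s ∣ Γ ⊢ ¬ ¬ φ → s ∣ Γ ⊢ φ
  -- induction on x (SMSO: deterministic formulae only).  Fresh z is index 0
  -- (first premise); fresh z, y are indices 0, 1 (second premise).
  ind   : ∀ {n m} {Γ : List (Formula n m)} {φ} (x : Fin n) → Restr s φ →
          s ∣ Zero zero ∷ map wkI Γ ⊢ renI (repl x zero suc) φ →
          s ∣ renI (repl x (suc zero) (λ i → suc (suc i))) φ
               ∷ S (suc zero) zero ∷ map (renI (λ i → suc (suc i))) Γ
            ⊢ renI (repl x zero (λ i → suc (suc i))) φ →
          s ∣ Γ ⊢ φ
  compr : ∀ {n m} {Γ : List (Formula n m)} {φ} (ψ : Formula (suc n) m) →
          s ≡ mso → s ∣ Γ ⊢ φ [ ψ /X] → s ∣ Γ ⊢ ∃₂ φ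
  ncompr : ∀ {n m} {Γ : List (Formula n m)} {φ} (ψ : Formula (suc n) m) →
          s ≡ smso → s ∣ Γ ⊢ φ [ ψ /X] → s ∣ Γ ⊢ ¬ ¬ ∃₂ φ
  scompr : ∀ {n m} {Γ : List (Formula n m)} {ψ} (φ̂ : Formula (suc n) m) →
          s ≡ smso → UniformlyBounded φ̂ →
          s ∣ Γ ⊢ ψ [ φ̂ /X] → s ∣ Γ ⊢ ∃₂ ψ

-- Double negation is a monad, so the logical rules translate by lifting.  The
-- premises of the arithmetic rules are atoms (or a negation), hence deterministic, so
-- SMSO may strip their double negations.  Induction on φ becomes induction on the
-- deterministic formula ¬ ¬ φ, double negation elimination becomes ¬ ¬ ¬ ¬ φ ⊢ ¬ ¬ φ,
-- and full comprehension becomes negative comprehension.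
module Submission where

open import Defs
open import Data.Nat using (ℕ)
open import Data.List using (List; _∷_)
open import Data.List.Relation.Unary.Any using (here; there)
open import Data.List.Relation.Binary.Subset.Propositional using (_⊆_)
open import Data.List.Relation.Binary.Subset.Propositional.Properties using (map⁺; ∷⁺ʳ)
open import Relation.Binary.PropositionalEquality using (refl)

private variable
  s : System
  n m : ℕ
  Γ Δ : List (Formula n m)
  φ ψ δ : Formula n m

weaken : Γ ⊆ Δ → s ∣ Γ ⊢ φ → s ∣ Δ ⊢ φ
weaken Γ⊆Δ (ax p) = ax (Γ⊆Δ p)
weaken Γ⊆Δ (cut d e) = cut (weaken Γ⊆Δ d) (weaken (∷⁺ʳ _ Γ⊆Δ) e)
weaken Γ⊆Δ (¬E d e) = ¬E (weaken Γ⊆Δ d) (weaken Γ⊆Δ e)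
weaken Γ⊆Δ (¬I d) = ¬I (weaken (∷⁺ʳ _ Γ⊆Δ) d)
weaken Γ⊆Δ (∧I d e) = ∧I (weaken Γ⊆Δ d) (weaken Γ⊆Δ e)
weaken Γ⊆Δ (∧E₁ d) = ∧E₁ (weaken Γ⊆Δ d)
weaken Γ⊆Δ (∧E₂ d) = ∧E₂ (weaken Γ⊆Δ d)
weaken Γ⊆Δ (∃I₁ y d) = ∃I₁ y (weaken Γ⊆Δ d)
weaken Γ⊆Δ (∃I₂ Y d) = ∃I₂ Y (weaken Γ⊆Δ d)
weaken Γ⊆Δ (∃E₁ d e) = ∃E₁ (weaken Γ⊆Δ d) (weaken (∷⁺ʳ _ (map⁺ wkI Γ⊆Δ)) e)
weaken Γ⊆Δ (∃E₂ d e) = ∃E₂ (weaken Γ⊆Δ d) (weaken (∷⁺ʳ _ (map⁺ wkP Γ⊆Δ)) e)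
weaken Γ⊆Δ (≐refl x) = ≐refl x
weaken Γ⊆Δ (≐subst φ d e) = ≐subst φ (weaken Γ⊆Δ d) (weaken Γ⊆Δ e)
weaken Γ⊆Δ (≤refl x) = ≤refl x
weaken Γ⊆Δ (≤trans d e) = ≤trans (weaken Γ⊆Δ d) (weaken Γ⊆Δ e)
weaken Γ⊆Δ (≤antisym d e) = ≤antisym (weaken Γ⊆Δ d) (weaken Γ⊆Δ e)
weaken Γ⊆Δ zeroEx = zeroEx
weaken Γ⊆Δ (zeroUniq d e) = zeroUniq (weaken Γ⊆Δ d) (weaken Γ⊆Δ e)
weaken Γ⊆Δ (succEx x) = succEx x
weaken Γ⊆Δ (succInj d e) = succInj (weaken Γ⊆Δ d) (weaken Γ⊆Δ e)
weaken Γ⊆Δ (succFun d e) = succFun (weaken Γ⊆Δ d) (weaken Γ⊆Δ e)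
weaken Γ⊆Δ (succZero d e) = succZero (weaken Γ⊆Δ d) (weaken Γ⊆Δ e)
weaken Γ⊆Δ (succ≤ d) = succ≤ (weaken Γ⊆Δ d)
weaken Γ⊆Δ (≤pred d e f) = ≤pred (weaken Γ⊆Δ d) (weaken Γ⊆Δ e) (weaken Γ⊆Δ f)
weaken Γ⊆Δ (dne r d) = dne r (weaken Γ⊆Δ d)
weaken Γ⊆Δ (ind x r base step) =
  ind x r (weaken (∷⁺ʳ _ (map⁺ wkI Γ⊆Δ)) base) (weaken (∷⁺ʳ _ (∷⁺ʳ _ (map⁺ _ Γ⊆Δ))) step)
weaken Γ⊆Δ (compr ψ eq d) = compr ψ eq (weaken Γ⊆Δ d)
weaken Γ⊆Δ (ncompr ψ eq d) = ncompr ψ eq (weaken Γ⊆Δ d)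
weaken Γ⊆Δ (scompr φ̂ eq bounded d) = scompr φ̂ eq bounded (weaken Γ⊆Δ d)

¬¬-intro : s ∣ Γ ⊢ φ → s ∣ Γ ⊢ ¬ ¬ φ
¬¬-intro d = ¬I (¬E (weaken there d) (ax (here refl)))

¬¬-bind : s ∣ Γ ⊢ ¬ ¬ φ → s ∣ φ ∷ Γ ⊢ ¬ ¬ ψ → s ∣ Γ ⊢ ¬ ¬ ψ
¬¬-bind d e =
  ¬I (¬E (¬I (¬E (ax (there (here refl))) (weaken (∷⁺ʳ _ there) e))) (weaken there d))

¬¬-map : s ∣ Γ ⊢ ¬ ¬ φ → s ∣ φ ∷ Γ ⊢ ψ → s ∣ Γ ⊢ ¬ ¬ ψ
¬¬-map d e = ¬¬-bind d (¬¬-intro e)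

¬¬⊥-elim : s ∣ Γ ⊢ ¬ ¬ ⊥ᶠ → s ∣ Γ ⊢ ⊥ᶠ
¬¬⊥-elim d = ¬E (¬I (ax (here refl))) d

¬¬¬¬-elim : s ∣ Γ ⊢ ¬ ¬ ¬ ¬ φ → s ∣ Γ ⊢ ¬ ¬ φ
¬¬¬¬-elim d = ¬I (¬E (¬¬-intro (ax (here refl))) (weaken there d))

mutual

  mso⇒smso-¬¬ : mso ∣ Γ ⊢ φ → smso ∣ Γ ⊢ ¬ ¬ φ
  mso⇒smso-¬¬ (ax p) = ¬¬-intro (ax p)
  mso⇒smso-¬¬ (cut d e) = ¬¬-bind (mso⇒smso-¬¬ d) (mso⇒smso-¬¬ e)
  mso⇒smso-¬¬ (¬E d e) = ¬¬-intro (¬E (mso⇒smso-¬¬ d) (mso⇒smso-¬¬ e))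
  mso⇒smso-¬¬ (¬I d) = ¬¬-intro (¬I (¬¬⊥-elim (mso⇒smso-¬¬ d)))
  mso⇒smso-¬¬ (∧I d e) = ¬¬-bind (mso⇒smso-¬¬ d)
    (¬¬-map (weaken there (mso⇒smso-¬¬ e)) (∧I (ax (there (here refl))) (ax (here refl))))
  mso⇒smso-¬¬ (∧E₁ d) = ¬¬-map (mso⇒smso-¬¬ d) (∧E₁ (ax (here refl)))
  mso⇒smso-¬¬ (∧E₂ d) = ¬¬-map (mso⇒smso-¬¬ d) (∧E₂ (ax (here refl)))
  mso⇒smso-¬¬ (∃I₁ y d) = ¬¬-map (mso⇒smso-¬¬ d) (∃I₁ y (ax (here refl)))
  mso⇒smso-¬¬ (∃I₂ Y d) = ¬¬-map (mso⇒smso-¬¬ d) (∃I₂ Y (ax (here refl)))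
  mso⇒smso-¬¬ (∃E₁ d e) =
    ¬¬-bind (mso⇒smso-¬¬ d) (∃E₁ (ax (here refl)) (weaken (∷⁺ʳ _ there) (mso⇒smso-¬¬ e)))
  mso⇒smso-¬¬ (∃E₂ d e) =
    ¬¬-bind (mso⇒smso-¬¬ d) (∃E₂ (ax (here refl)) (weaken (∷⁺ʳ _ there) (mso⇒smso-¬¬ e)))
  mso⇒smso-¬¬ (≐refl x) = ¬¬-intro (≐refl x)
  mso⇒smso-¬¬ (≐subst φ d e) = ≐subst (¬ ¬ φ) (mso⇒smso-¬¬ d) (mso⇒smso-det (det-≐ _ _) e)
  mso⇒smso-¬¬ (≤refl x) = ¬¬-intro (≤refl x)
  mso⇒smso-¬¬ (≤trans d e) =
    ¬¬-intro (≤trans (mso⇒smso-det (det-≤ _ _) d) (mso⇒smso-det (det-≤ _ _) e))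
  mso⇒smso-¬¬ (≤antisym d e) =
    ¬¬-intro (≤antisym (mso⇒smso-det (det-≤ _ _) d) (mso⇒smso-det (det-≤ _ _) e))
  mso⇒smso-¬¬ zeroEx = ¬¬-intro zeroEx
  mso⇒smso-¬¬ (zeroUniq d e) =
    ¬¬-intro (zeroUniq (mso⇒smso-det (det-Z _) d) (mso⇒smso-det (det-Z _) e))
  mso⇒smso-¬¬ (succEx x) = ¬¬-intro (succEx x)
  mso⇒smso-¬¬ (succInj d e) =
    ¬¬-intro (succInj (mso⇒smso-det (det-S _ _) d) (mso⇒smso-det (det-S _ _) e))
  mso⇒smso-¬¬ (succFun d e) =
    ¬¬-intro (succFun (mso⇒smso-det (det-S _ _) d) (mso⇒smso-det (det-S _ _) e))
  mso⇒smso-¬¬ (succZero d e) =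
    ¬¬-intro (succZero (mso⇒smso-det (det-S _ _) d) (mso⇒smso-det (det-Z _) e))
  mso⇒smso-¬¬ (succ≤ d) = ¬¬-intro (succ≤ (mso⇒smso-det (det-S _ _) d))
  mso⇒smso-¬¬ (≤pred d e f) = ¬¬-intro (≤pred (mso⇒smso-det (det-S _ _) d)
    (mso⇒smso-det (det-≤ _ _) e) (mso⇒smso-det (det-¬ _) f))
  mso⇒smso-¬¬ (dne _ d) = ¬¬¬¬-elim (mso⇒smso-¬¬ d)
  mso⇒smso-¬¬ {φ = φ} (ind x _ base step) = ind x (det-¬ (¬ φ)) (mso⇒smso-¬¬ base)
    (¬¬-bind (ax (here refl)) (weaken (∷⁺ʳ _ there) (mso⇒smso-¬¬ step)))
  mso⇒smso-¬¬ (compr ψ _ d) = ¬¬-bind (mso⇒smso-¬¬ d) (ncompr ψ refl (ax (here refl)))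
  mso⇒smso-¬¬ (ncompr _ () _)
  mso⇒smso-¬¬ (scompr _ () _ _)

  mso⇒smso-det : Det δ → mso ∣ Γ ⊢ δ → smso ∣ Γ ⊢ δ
  mso⇒smso-det r d = dne r (mso⇒smso-¬¬ d)

theorem3p6 : ∀ {n m} (Γ : List (Formula n m)) (φ : Formula n m) →
    mso ∣ Γ ⊢ φ → smso ∣ Γ ⊢ ¬ ¬ φ
theorem3p6 _ _ = mso⇒smso-¬¬
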